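{- Let $(a_n)_{n\ge0}$ be a sequence of (say, real) numbers and let $\mathbf{s}_2=(b_n)_{n\ge0}$ be a sequence of numbers; let $\mathbf{s}_1$ be the sequence all of whose terms are $0$. Then for every integer $k\ge0$, $$t^{\mathbf{s}_2}_{k,n}-t^{\mathbf{s}_1}_{k,n}=\sum_{i=0}^{k-1}\binom{n}{i}b_{k-1-i}\quad\text{for all } n\ge0.$$
   Context: For a sequence $(a_n)_{n\ge0}$ and a number $b$, the partial sum operator $P_b$ produces the sequence $P_b((a_n)_{n\ge0})=(a'_n)_{n\ge0}$ with $a'_n=b+\sum_{i=0}^{n-1}a_i$ (so $a'_0=b$). For a fixed base sequence $(a_n)_{n\ge0}$ and a sequence $\mathbf{s}=(b_n)_{n\ge0}$, define $(t^{\mathbf{s}}_{k,n})_{n\ge0}$ for $k\ge0$ by $(t^{\mathbf{s}}_{0,n})_{n\ge0}=(a_n)_{n\ge0}$ and $(t^{\mathbf{s}}_{k,n})_{n\ge0}=P_{b_{k-1}}\big((t^{\mathbf{s}}_{k-1,n})_{n\ge0}\big)$ for $k\ge1$, i.e. $P_{b_{k-1}}(\cdots P_{b_1}(P_{b_0}((a_n)_{n\ge0})))$. Binomial coefficients $\binom{n}{i}$ with $i>n$ are $0$. -}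

module Defs where

open import Level using (Level)
open import Data.Nat using (ℕ; zero; suc; _∸_)
open import Data.Nat.Combinatorics using (_C_)
open import Algebra.Bundles using (CommutativeRing)

module _ {c ℓ : Level} (R : CommutativeRing c ℓ) where
  open CommutativeRing R

  _×ᴿ_ : ℕ → Carrier → Carrier
  zero  ×ᴿ x = 0#
  suc m ×ᴿ x = x + (m ×ᴿ x)

  sumTo : ℕ → (ℕ → Carrier) → Carrier
  sumTo zero    f = 0#
  sumTo (suc n) f = sumTo n f + f n

  P : Carrier → (ℕ → Carrier) → (ℕ → Carrier)
  P b a n = b + sumTo n a

  t : (ℕ → Carrier) → (ℕ → Carrier) → ℕ → ℕ → Carrier
  t a s zero    = a
  t a s (suc k) = P (s k) (t a s k)

  zeroSeq : ℕ → Carrier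
  zeroSeq _ = 0#

module Submission where

-- The difference of the two iterates is itself an iterate: since P_b is affine,
-- P_b x − P_0 y = P_b (x − y), so t^{s₂}_k − t^{s₁}_k is obtained by iterating the
-- partial sum operators with offsets b from the zero sequence. That iterate has the
-- stated binomial closed form, because Σ_{m<n} C(m,i) = C(n,i+1) (hockey stick)
-- turns a partial sum of the k-th closed form into the (k+1)-st.

open import Defs
open import Data.Nat using (ℕ; zero; suc; _∸_)
import Data.Nat as ℕ
open import Data.Nat.Properties using (∸-+-assoc)
open import Data.Nat.Combinatorics using (_C_; nCk+nC[k+1]≡[n+1]C[k+1])
open import Algebra.Bundles using (CommutativeRing)
open import Relation.Binary.PropositionalEquality using (cong)
import Relation.Binary.Reasoning.Setoid as SetoidReasoning
import Algebra.Properties.CommutativeSemigroup as CommutativeSemigroupProperties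
import Algebra.Properties.AbelianGroup as AbelianGroupProperties

module _ {c ℓ} (R : CommutativeRing c ℓ) where
  open CommutativeRing R
  open SetoidReasoning setoid
  open CommutativeSemigroupProperties +-commutativeSemigroup using (interchange)
  open AbelianGroupProperties +-abelianGroup using (⁻¹-∙-comm)

  private
    ∑ : ℕ → (ℕ → Carrier) → Carrier
    ∑ = sumTo R

    _×_ : ℕ → Carrier → Carrier
    _×_ = _×ᴿ_ R

  ×-distribʳ-+ : ∀ p q x → (p ℕ.+ q) × x ≈ p × x + q × x
  ×-distribʳ-+ zero    q x = sym (+-identityˡ _)
  ×-distribʳ-+ (suc p) q x = trans (+-congˡ (×-distribʳ-+ p q x)) (sym (+-assoc _ _ _))

  sumTo-cong : ∀ n {f g} → (∀ m → f m ≈ g m) → ∑ n f ≈ ∑ n g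
  sumTo-cong zero    f≈g = refl
  sumTo-cong (suc n) f≈g = +-cong (sumTo-cong n f≈g) (f≈g n)

  sumTo-zero : ∀ n → ∑ n (λ _ → 0#) ≈ 0#
  sumTo-zero zero    = refl
  sumTo-zero (suc n) = trans (+-identityʳ _) (sumTo-zero n)

  sumTo-distrib-+ : ∀ n f g → ∑ n f + ∑ n g ≈ ∑ n (λ m → f m + g m)
  sumTo-distrib-+ zero    f g = +-identityˡ 0#
  sumTo-distrib-+ (suc n) f g = begin
    (∑ n f + f n) + (∑ n g + g n) ≈⟨ interchange _ _ _ _ ⟩
    (∑ n f + ∑ n g) + (f n + g n) ≈⟨ +-congʳ (sumTo-distrib-+ n f g) ⟩
    ∑ n (λ m → f m + g m) + (f n + g n) ∎

  sumTo-distrib-- : ∀ n f g → ∑ n f - ∑ n g ≈ ∑ n (λ m → f m - g m)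
  sumTo-distrib-- zero    f g = -‿inverseʳ 0#
  sumTo-distrib-- (suc n) f g = begin
    (∑ n f + f n) - (∑ n g + g n)     ≈⟨ +-congˡ (sym (⁻¹-∙-comm _ _)) ⟩
    (∑ n f + f n) + (- ∑ n g - g n)   ≈⟨ interchange _ _ _ _ ⟩
    (∑ n f - ∑ n g) + (f n - g n)     ≈⟨ +-congʳ (sumTo-distrib-- n f g) ⟩
    ∑ n (λ m → f m - g m) + (f n - g n) ∎

  sumTo-comm : ∀ n k (g : ℕ → ℕ → Carrier) →
               ∑ n (λ m → ∑ k (g m)) ≈ ∑ k (λ i → ∑ n (λ m → g m i))
  sumTo-comm zero    k g = sym (sumTo-zero k)
  sumTo-comm (suc n) k g = begin
    ∑ n (λ m → ∑ k (g m)) + ∑ k (g n)         ≈⟨ +-congʳ (sumTo-comm n k g) ⟩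
    ∑ k (λ i → ∑ n (λ m → g m i)) + ∑ k (g n) ≈⟨ sumTo-distrib-+ k _ _ ⟩
    ∑ k (λ i → ∑ n (λ m → g m i) + g n i)     ∎

  sumTo-unfoldˡ : ∀ k f → ∑ (suc k) f ≈ f 0 + ∑ k (λ i → f (suc i))
  sumTo-unfoldˡ zero    f = trans (+-identityˡ _) (sym (+-identityʳ _))
  sumTo-unfoldˡ (suc k) f = begin
    ∑ (suc k) f + f (suc k)                   ≈⟨ +-congʳ (sumTo-unfoldˡ k f) ⟩
    (f 0 + ∑ k (λ i → f (suc i))) + f (suc k) ≈⟨ +-assoc _ _ _ ⟩
    f 0 + (∑ k (λ i → f (suc i)) + f (suc k)) ∎

  sumTo-C-hockeyStick : ∀ n i x → ∑ n (λ m → (m C i) × x) ≈ (n C suc i) × x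
  sumTo-C-hockeyStick zero    i x = refl
  sumTo-C-hockeyStick (suc n) i x = begin
    ∑ n (λ m → (m C i) × x) + (n C i) × x ≈⟨ +-congʳ (sumTo-C-hockeyStick n i x) ⟩
    (n C suc i) × x + (n C i) × x         ≈⟨ +-comm _ _ ⟩
    (n C i) × x + (n C suc i) × x         ≈⟨ ×-distribʳ-+ (n C i) (n C suc i) x ⟨
    (n C i ℕ.+ n C suc i) × x             ≡⟨ cong (_× x) (nCk+nC[k+1]≡[n+1]C[k+1] n i) ⟩
    (suc n C suc i) × x                   ∎

  P-sub-P-zero : ∀ b x y n → P R b x n - P R 0# y n ≈ P R b (λ m → x m - y m) n
  P-sub-P-zero b x y n = begin
    (b + ∑ n x) - (0# + ∑ n y) ≈⟨ +-congˡ (-‿cong (+-identityˡ _)) ⟩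
    (b + ∑ n x) - ∑ n y        ≈⟨ +-assoc _ _ _ ⟩
    b + (∑ n x - ∑ n y)        ≈⟨ +-congˡ (sumTo-distrib-- n x y) ⟩
    b + ∑ n (λ m → x m - y m)  ∎

  t-sub-t-zeroSeq : ∀ a b k n → t R a b k n - t R a (zeroSeq R) k n ≈ t R (zeroSeq R) b k n
  t-sub-t-zeroSeq a b zero    n = -‿inverseʳ (a n)
  t-sub-t-zeroSeq a b (suc k) n = begin
    P R (b k) (t R a b k) n - P R 0# (t R a (zeroSeq R) k) n
      ≈⟨ P-sub-P-zero (b k) _ _ n ⟩
    b k + ∑ n (λ m → t R a b k m - t R a (zeroSeq R) k m)
      ≈⟨ +-congˡ (sumTo-cong n (t-sub-t-zeroSeq a b k)) ⟩
    b k + ∑ n (t R (zeroSeq R) b k) ∎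

  binomialSum : (ℕ → Carrier) → ℕ → ℕ → Carrier
  binomialSum b k n = ∑ k (λ i → (n C i) × b (k ∸ 1 ∸ i))

  binomialSum-suc : ∀ b k n → binomialSum b (suc k) n ≈ b k + ∑ n (binomialSum b k)
  binomialSum-suc b k n = begin
    binomialSum b (suc k) n
      ≈⟨ sumTo-unfoldˡ k _ ⟩
    1 × b k + ∑ k (λ i → (n C suc i) × b (k ∸ suc i))
      ≈⟨ +-cong (+-identityʳ _) (sumTo-cong k reindex) ⟩
    b k + ∑ k (λ i → (n C suc i) × b (k ∸ 1 ∸ i))
      ≈⟨ +-congˡ (sumTo-cong k (λ i → sumTo-C-hockeyStick n i _)) ⟨
    b k + ∑ k (λ i → ∑ n (λ m → (m C i) × b (k ∸ 1 ∸ i)))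
      ≈⟨ +-congˡ (sumTo-comm n k _) ⟨
    b k + ∑ n (binomialSum b k) ∎
    where
    reindex : ∀ i → (n C suc i) × b (k ∸ suc i) ≈ (n C suc i) × b (k ∸ 1 ∸ i)
    reindex i = sym (reflexive (cong (λ j → (n C suc i) × b j) (∸-+-assoc k 1 i)))

  t-zeroSeq≈binomialSum : ∀ b k n → t R (zeroSeq R) b k n ≈ binomialSum b k n
  t-zeroSeq≈binomialSum b zero    n = refl
  t-zeroSeq≈binomialSum b (suc k) n = begin
    b k + ∑ n (t R (zeroSeq R) b k) ≈⟨ +-congˡ (sumTo-cong n (t-zeroSeq≈binomialSum b k)) ⟩
    b k + ∑ n (binomialSum b k)     ≈⟨ binomialSum-suc b k n ⟨
    binomialSum b (suc k) n         ∎

lemma3p3 : ∀ {c ℓ} (R : CommutativeRing c ℓ) (a b : ℕ → CommutativeRing.Carrier R) (k n : ℕ) →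
    CommutativeRing._≈_ R
      (CommutativeRing._-_ R (t R a b k n) (t R a (zeroSeq R) k n))
      (sumTo R k (λ i → _×ᴿ_ R (n C i) (b (k ∸ 1 ∸ i))))
lemma3p3 R a b k n =
  CommutativeRing.trans R (t-sub-t-zeroSeq R a b k n) (t-zeroSeq≈binomialSum R b k n)
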